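{- There exists a bipartite graph $H$ with countably infinite vertex set that has property FIN.
   Context: A labeling of the vertices of a graph by $\mathbb{N}$ is a bijection from the vertex set to $\mathbb{N}$; an increasing path is a path $v_1,v_2,\dots$ (finite or infinite) with strictly increasing labels. A countable graph has property FIN if for every labeling of its vertices by $\mathbb{N}$ and every $k\in\mathbb{N}$ there is an increasing path of length $k$, but there exists a labeling of its vertices by $\mathbb{N}$ with no infinite increasing path. -}

module Defs where

open import Data.Nat using (ℕ; suc; _<_)
open import Data.Fin using (Fin; inject₁) renaming (suc to fsuc)
open import Data.Bool using (Bool)
open import Data.Product using (Σ; _×_)
open import Relation.Nullary using (¬_)
open import Relation.Binary.PropositionalEquality using (_≡_)
open import Function.Bundles using (_⤖_; Bijection)

record CountableGraph : Set₁ where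
  field
    Vertex     : Set
    countable  : Vertex ⤖ ℕ
    Adj        : Vertex → Vertex → Set
    Adj-sym    : ∀ {u v} → Adj u v → Adj v u
    Adj-irrefl : ∀ {v} → ¬ Adj v v

module _ (G : CountableGraph) where
  open CountableGraph G

  Bipartite : Set
  Bipartite = Σ (Vertex → Bool) λ c → ∀ {u v} → Adj u v → ¬ (c u ≡ c v)

  Labeling : Set
  Labeling = Vertex ⤖ ℕ

  label : Labeling → Vertex → ℕ
  label L = Bijection.to L

  -- increasing path of length k (k edges, vertices p 0, …, p k)
  IncreasingPath : Labeling → ℕ → Set
  IncreasingPath L k =
    Σ (Fin (suc k) → Vertex) λ p →
      ∀ (i : Fin k) → Adj (p (inject₁ i)) (p (fsuc i))
                     × label L (p (inject₁ i)) < label L (p (fsuc i))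

  InfiniteIncreasingPath : Labeling → Set
  InfiniteIncreasingPath L =
    Σ (ℕ → Vertex) λ p →
      ∀ (i : ℕ) → Adj (p i) (p (suc i)) × label L (p i) < label L (p (suc i))

  FIN : Set
  FIN = (∀ (L : Labeling) (k : ℕ) → IncreasingPath L k)
      × Σ Labeling (λ L → ¬ InfiniteIncreasingPath L)

module Submission where

-- Give every natural number n a level ℓ(n) and join u < v by an edge exactly
-- when ℓ(u) = ℓ(v) + 1 (a "layered graph").  Colouring vertices by the parity
-- of their level shows the graph is bipartite for ANY level function.
-- Under the identity labeling an increasing path always steps from u to some
-- v > u, hence one level down; levels cannot decrease forever, so there is no
-- infinite increasing path.  If moreover every level is infinite, then for any
-- labeling each vertex of level b + 1 has a neighbour on level b with a larger
-- label (an injective map ℕ → ℕ is unbounded, so some of the infinitely many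
-- candidates above it carries a larger label); iterating from any vertex of
-- level k gives an increasing path of length k.

open import Defs
open import Data.Bool using (Bool; true; not)
open import Data.Bool.Properties using (not-¬)
open import Data.Empty using (⊥-elim)
open import Data.Fin using (Fin; toℕ; fromℕ<; inject₁) renaming (zero to fzero; suc to fsuc; _<_ to _<ᶠ_)
import Data.Fin.Properties as Fin
open import Data.Nat using (ℕ; zero; suc; _+_; _<_; _≤_; _<?_; s≤s)
open import Data.Nat.GeneralisedArithmetic using (fold; fold-+)
open import Data.Nat.Induction using (<-wellFounded)
open import Data.Nat.Properties
open import Data.Product using (Σ; ∃; ∃₂; _×_; _,_; proj₁; proj₂)
open import Data.Sum using (_⊎_; inj₁; inj₂)
open import Function.Bundles using (Bijection)
open import Function.Construct.Identity using (⤖-id)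
open import Function.Definitions using (Injective)
open import Induction.InfiniteDescent
  using (InfiniteDescendingSequence; Descent; descent∧wf⇒empty)
open import Relation.Nullary using (¬_; yes; no)
open import Relation.Binary.PropositionalEquality

-- An injective map ℕ → ℕ is unbounded: among f 0, …, f (m + 1) — m + 2
-- distinct values — not all can lie in {0, …, m} (pigeonhole).
injective⇒unbounded : (f : ℕ → ℕ) → Injective _≡_ _≡_ f → ∀ m → ∃ λ i → m < f i
injective⇒unbounded f f-inj m with Fin.any? {n = suc (suc m)} (λ k → m <? f (toℕ k))
... | yes (k , m<fk) = toℕ k , m<fk
... | no none = ⊥-elim (noCollision (Fin.pigeonhole (n<1+n (suc m)) squeeze))
  where
  bounded : ∀ k → f (toℕ k) < suc m
  bounded k with m <? f (toℕ k)
  ... | yes m<fk = ⊥-elim (none (k , m<fk))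
  ... | no m≮fk = s≤s (≮⇒≥ m≮fk)

  squeeze : Fin (suc (suc m)) → Fin (suc m)
  squeeze k = fromℕ< (bounded k)

  noCollision : ¬ (∃₂ λ i j → i <ᶠ j × squeeze i ≡ squeeze j)
  noCollision (i , j , i<j , same) =
    Fin.<-irrefl (Fin.toℕ-injective (f-inj (Fin.fromℕ<-injective _ _ (bounded i) (bounded j) same))) i<j

-- If e is injective with i ≤ e i and g is injective, then some value e i lies
-- above any given m while g (e i) lies above any given n: the candidates
-- e (m + 1 + j) all exceed m, and their g-values are unbounded.
aboveOnBoth : (e g : ℕ → ℕ) → Injective _≡_ _≡_ e → Injective _≡_ _≡_ g → (∀ i → i ≤ e i) →
              ∀ m n → ∃ λ i → m < e i × n < g (e i)
aboveOnBoth e g e-inj g-inj e-grows m n =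
  let (j , n<g) = injective⇒unbounded candidate candidate-inj n
  in suc m + j , ≤-trans (m≤m+n (suc m) j) (e-grows (suc m + j)) , n<g
  where
  candidate : ℕ → ℕ
  candidate j = g (e (suc m + j))

  candidate-inj : Injective _≡_ _≡_ candidate
  candidate-inj same = +-cancelˡ-≡ (suc m) _ _ (e-inj (g-inj same))

noDescendingSequence : (f : ℕ → ℕ) → ¬ InfiniteDescendingSequence _<_ f
noDescendingSequence f decreasing = descent∧wf⇒empty descent <-wellFounded (f 0) (0 , refl)
  where
  descent : Descent _<_ (λ x → ∃ λ n → f n ≡ x)
  descent (n , refl) = f (suc n) , decreasing n , suc n , refl

-- A level function has infinite levels if each level b is enumerated by an
-- injective map e with i ≤ e i (so the enumeration eventually leaves any
-- initial segment of ℕ).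
InfiniteLevels : (ℕ → ℕ) → Set
InfiniteLevels level =
  ∀ b → Σ (ℕ → ℕ) λ e → Injective _≡_ _≡_ e × (∀ i → level (e i) ≡ b) × (∀ i → i ≤ e i)

isEven : ℕ → Bool
isEven zero = true
isEven (suc n) = not (isEven n)

module LayeredGraph (level : ℕ → ℕ) where

  Down : ℕ → ℕ → Set
  Down u v = u < v × level u ≡ suc (level v)

  Adjacent : ℕ → ℕ → Set
  Adjacent u v = Down u v ⊎ Down v u

  graph : CountableGraph
  graph = record
    { Vertex     = ℕ
    ; countable  = ⤖-id ℕ
    ; Adj        = Adjacent
    ; Adj-sym    = λ { (inj₁ d) → inj₂ d ; (inj₂ d) → inj₁ d }
    ; Adj-irrefl = λ { (inj₁ (u<u , _)) → <-irrefl refl u<u ; (inj₂ (u<u , _)) → <-irrefl refl u<u }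
    }

  bipartite : Bipartite graph
  bipartite = (λ n → isEven (level n)) , λ {u} {v} → differ u v
    where
    parity-flip : ∀ u v → Down u v → ¬ (isEven (level u) ≡ isEven (level v))
    parity-flip u v (_ , up) same =
      not-¬ refl (trans (sym same) (cong isEven up))

    differ : ∀ u v → Adjacent u v → ¬ (isEven (level u) ≡ isEven (level v))
    differ u v (inj₁ d) same = parity-flip u v d same
    differ u v (inj₂ d) same = parity-flip v u d (sym same)

  edge-descends : ∀ {u v} → Adjacent u v → u < v → level v < level u
  edge-descends (inj₁ (_ , up)) _ = ≤-reflexive (sym up)
  edge-descends (inj₂ (v<u , _)) u<v = ⊥-elim (<-asym u<v v<u)

  noInfiniteIncreasingPath : ¬ InfiniteIncreasingPath graph (⤖-id ℕ)
  noInfiniteIncreasingPath (p , increasing) =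
    noDescendingSequence (λ i → level (p i))
      (λ i → edge-descends (proj₁ (increasing i)) (proj₂ (increasing i)))

  module _ (levels : InfiniteLevels level) (L : Labeling graph) where

    lab : ℕ → ℕ
    lab = label graph L

    -- A vertex on level b + 1 has a neighbour on level b with larger label:
    -- among the level-b vertices, one lies above v and has label above lab v.
    step-down : ∀ b v → level v ≡ suc b →
                ∃ λ w → level w ≡ b × Adjacent v w × lab v < lab w
    step-down b v v-on-b+1 =
      let (e , e-inj , on-b , e-grows) = levels b
          (i , v<w , labv<labw) = aboveOnBoth e lab e-inj (Bijection.injective L) e-grows v (lab v)
          v-up = trans v-on-b+1 (cong suc (sym (on-b i)))
      in e i , on-b i , inj₁ (v<w , v-up) , labv<labw

    PathFrom : ℕ → ℕ → Set
    PathFrom k v =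
      Σ (Fin (suc k) → ℕ) λ p → p fzero ≡ v ×
        (∀ (i : Fin k) → Adjacent (p (inject₁ i)) (p (fsuc i)) × lab (p (inject₁ i)) < lab (p (fsuc i)))

    prepend : ∀ {k v w} → Adjacent v w → lab v < lab w → PathFrom k w → PathFrom (suc k) v
    prepend {k} {v} {w} v~w labv<labw (p , p0≡w , increasing) = q , refl , increasing′
      where
      q : Fin (suc (suc k)) → ℕ
      q fzero = v
      q (fsuc j) = p j

      increasing′ : ∀ (i : Fin (suc k)) →
                    Adjacent (q (inject₁ i)) (q (fsuc i)) × lab (q (inject₁ i)) < lab (q (fsuc i))
      increasing′ fzero rewrite p0≡w = v~w , labv<labw
      increasing′ (fsuc i) = increasing i

    descendingPath : ∀ b v → level v ≡ b → PathFrom b v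
    descendingPath zero v _ = (λ _ → v) , refl , λ ()
    descendingPath (suc b) v v-on-b+1 =
      let (w , w-on-b , v~w , labv<labw) = step-down b v v-on-b+1
      in prepend v~w labv<labw (descendingPath b w w-on-b)

    longPaths : ∀ k → IncreasingPath graph L k
    longPaths k =
      let (e , _ , on-k , _) = levels k
          (p , _ , increasing) = descendingPath k (e 0) (on-k 0)
      in p , increasing

-- The Cantor enumeration of ℕ × ℕ, walking the anti-diagonals
-- (0,0), (1,0), (0,1), (2,0), (1,1), (0,2), …  from bottom-right to top-left.
diagonalStep : ℕ × ℕ → ℕ × ℕ
diagonalStep (zero , c) = suc c , 0
diagonalStep (suc a , c) = a , suc c

unpair : ℕ → ℕ × ℕ
unpair n = fold (0 , 0) diagonalStep n

-- Triangular numbers: tri d is the index where the d-th anti-diagonal starts.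
tri : ℕ → ℕ
tri zero = 0
tri (suc d) = suc d + tri d

tri-≥ : ∀ d → d ≤ tri d
tri-≥ zero = ≤-refl
tri-≥ (suc d) = m≤m+n (suc d) (tri d)

walkDiagonal : ∀ c x y → fold (x + c , y) diagonalStep c ≡ (x , y + c)
walkDiagonal zero x y rewrite +-identityʳ x | +-identityʳ y = refl
walkDiagonal (suc c) x y rewrite +-suc x c | walkDiagonal c (suc x) y | +-suc y c = refl

unpair-tri : ∀ d → unpair (tri d) ≡ (d , 0)
unpair-tri zero = refl
unpair-tri (suc d) = begin
  fold (0 , 0) diagonalStep (suc d + tri d)      ≡⟨ fold-+ (0 , 0) diagonalStep (suc d) ⟩
  fold (unpair (tri d)) diagonalStep (suc d)     ≡⟨ cong (λ s → fold s diagonalStep (suc d)) (unpair-tri d) ⟩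
  diagonalStep (fold (0 + d , 0) diagonalStep d) ≡⟨ cong diagonalStep (walkDiagonal d 0 0) ⟩
  (suc d , 0)                                    ∎
  where open ≡-Reasoning

pair : ℕ → ℕ → ℕ
pair i b = b + tri (i + b)

unpair-pair : ∀ i b → unpair (pair i b) ≡ (i , b)
unpair-pair i b = begin
  fold (0 , 0) diagonalStep (b + tri (i + b)) ≡⟨ fold-+ (0 , 0) diagonalStep b ⟩
  fold (unpair (tri (i + b))) diagonalStep b  ≡⟨ cong (λ s → fold s diagonalStep b) (unpair-tri (i + b)) ⟩
  fold (i + b , 0) diagonalStep b             ≡⟨ walkDiagonal b i 0 ⟩
  (i , b)                                     ∎
  where open ≡-Reasoning

-- The level of n is the second coordinate of the n-th pair; level b is
-- enumerated by i ↦ pair i b.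
cantorLevel : ℕ → ℕ
cantorLevel n = proj₂ (unpair n)

cantorLevels-infinite : InfiniteLevels cantorLevel
cantorLevels-infinite b = (λ i → pair i b) , pair-inj , on-b , grows
  where
  pair-inj : Injective _≡_ _≡_ (λ i → pair i b)
  pair-inj {i} {j} same = begin
    i                       ≡⟨ cong proj₁ (unpair-pair i b) ⟨
    proj₁ (unpair (pair i b)) ≡⟨ cong (λ n → proj₁ (unpair n)) same ⟩
    proj₁ (unpair (pair j b)) ≡⟨ cong proj₁ (unpair-pair j b) ⟩
    j                       ∎
    where open ≡-Reasoning

  on-b : ∀ i → cantorLevel (pair i b) ≡ b
  on-b i = cong proj₂ (unpair-pair i b)

  grows : ∀ i → i ≤ pair i b
  grows i = ≤-trans (m≤m+n i b) (≤-trans (tri-≥ (i + b)) (m≤n+m (tri (i + b)) b))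

open LayeredGraph cantorLevel

proposition3p4 : Σ CountableGraph (λ H → Bipartite H × FIN H)
proposition3p4 =
  graph , bipartite , longPaths cantorLevels-infinite , ⤖-id ℕ , noInfiniteIncreasingPath
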